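{- Let $k,d,\lambda$ be positive integers with $d\ge\lambda$ and $k\ge\lambda+1$. Let $t_1<\cdots<t_n$ be positive reals, $v_i=\gamma(t_i)$ where $\gamma(t)=(t,t^2,\ldots,t^d)$, and $V=\{v_1,\ldots,v_n\}$. Let $1\le i_1<i_2<\cdots<i_{d-\lambda+1}\le n$, put $w_j=v_{i_j}$, $T=\{w_1,\ldots,w_{d-\lambda+1}\}$, and $A_1=\{v_1,\ldots,v_{i_1-1}\}$, $A_j=\{v_i: i_{j-1}<i<i_j\}$ for $j\in\{2,\ldots,d-\lambda+1\}$, $A_{d-\lambda+2}=\{v_{i_{d-\lambda+1}+1},\ldots,v_n\}$. If $\operatorname{aff}(T)$ intersects $\operatorname{conv}(K)$ for every $k$-element subset $K\subseteq V$, then for every subset $S\subseteq[d-\lambda+2]$ with $OD(S)\le\lambda-1$ we have $$\sum_{\alpha\in S}|A_\alpha|\le k-1.$$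
   Context: $[n]=\{1,\ldots,n\}$. For a set $S$ of integers $x_1<\cdots<x_r$, $OD(S)$ is the number of odd integers among $x_2-x_1,\ldots,x_r-x_{r-1}$. $\operatorname{aff}$ denotes affine hull and $\operatorname{conv}$ convex hull. -}

module Defs where

open import Level using (0ℓ)
open import Data.Nat as Nat using (ℕ; zero; suc; _∸_; _%_; _≤?_)
open import Data.Bool using (Bool; true; false; _∧_; if_then_else_)
open import Data.Fin as Fin using (Fin; toℕ)
open import Data.Fin.Subset using (Subset; _∈_; _∉_; ∣_∣)
open import Data.Fin.Subset.Properties using (_∈?_)
open import Data.Vec as Vec using (Vec; _∷_; _∷ʳ_; tabulate; lookup)
open import Data.List as List using (List; []; _∷_)
open import Data.Product using (Σ; _×_; ∃)
open import Data.Sum using (_⊎_)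
open import Relation.Nullary using (¬_; does)
open import Relation.Binary.PropositionalEquality using (_≡_; _≢_)
open import Relation.Binary.Structures using (IsStrictTotalOrder)
import Algebra.Structures as AS

record RealField : Set₁ where
  infixl 6 _+_
  infixl 7 _*_
  infix  4 _<_ _≤_
  field
    ℝ    : Set
    _+_  : ℝ → ℝ → ℝ
    _*_  : ℝ → ℝ → ℝ
    -_   : ℝ → ℝ
    0ℝ   : ℝ
    1ℝ   : ℝ
    _<_  : ℝ → ℝ → Set
    isCommutativeRing   : AS.IsCommutativeRing (_≡_ {A = ℝ}) _+_ _*_ -_ 0ℝ 1ℝ
    isStrictTotalOrder  : IsStrictTotalOrder _≡_ _<_
    0≢1      : 0ℝ ≢ 1ℝ
    inverse  : ∀ x → x ≢ 0ℝ → Σ ℝ (λ y → x * y ≡ 1ℝ)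
    +-mono-< : ∀ {x y} z → x < y → x + z < y + z
    *-pos    : ∀ {x y} → 0ℝ < x → 0ℝ < y → 0ℝ < x * y

  _≤_ : ℝ → ℝ → Set
  x ≤ y = x < y ⊎ x ≡ y

  IsUpperBound : (ℝ → Set) → ℝ → Set
  IsUpperBound P b = ∀ x → P x → x ≤ b

  field
    completeness : (P : ℝ → Set) → ∃ P → ∃ (IsUpperBound P) →
                   Σ ℝ (λ s → IsUpperBound P s × (∀ b → IsUpperBound P b → s ≤ b))

module _ (R : RealField) where
  open RealField R

  Σℝ : ∀ {n} → (Fin n → ℝ) → ℝ
  Σℝ {zero}  f = 0ℝ
  Σℝ {suc n} f = f Fin.zero + Σℝ (λ i → f (Fin.suc i))

  _^_ : ℝ → ℕ → ℝ
  x ^ zero  = 1ℝ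
  x ^ suc m = x * (x ^ m)

  Point : ℕ → Set
  Point d = Fin d → ℝ

  γ : (d : ℕ) → ℝ → Point d
  γ d t c = t ^ suc (toℕ c)

  InAff : ∀ {d m} → (Fin m → Point d) → Point d → Set
  InAff {d} {m} w x = Σ (Fin m → ℝ) λ μ →
    Σℝ μ ≡ 1ℝ × (∀ c → Σℝ (λ j → μ j * w j c) ≡ x c)

  InConv : ∀ {d n} → (Fin n → Point d) → Subset n → Point d → Set
  InConv {d} {n} v K x = Σ (Fin n → ℝ) λ ν →
    (∀ p → 0ℝ ≤ ν p) × (∀ p → p ∉ K → ν p ≡ 0ℝ) × Σℝ ν ≡ 1ℝ ×
    (∀ c → Σℝ (λ p → ν p * v p c) ≡ x c)

  AffMeetsConv : ∀ {d m n} → (Fin m → Point d) → (Fin n → Point d) → Subset n → Set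
  AffMeetsConv {d} w v K = Σ (Point d) λ x → InAff w x × InConv v K x

-- Combinatorial part (indices are 0-based: Fin n position p ↔ v_{p+1},
-- Fin (suc m) position α ↔ A_{α+1}).

-- A_α for the chosen indices i : Fin m → Fin n (0-based).
-- A_α = { p : lower α ≤ p < upper α }
lowerA : ∀ {m n} → (Fin m → Fin n) → Fin (suc m) → ℕ
lowerA i α = lookup (0 ∷ tabulate (λ j → suc (toℕ (i j)))) α

upperA : ∀ {m n} → (Fin m → Fin n) → Fin (suc m) → ℕ
upperA {m} {n} i α = lookup (tabulate (λ j → toℕ (i j)) ∷ʳ n) α

blockA : ∀ {m n} → (Fin m → Fin n) → Fin (suc m) → Subset n
blockA i α = tabulate λ p →
  does (lowerA i α ≤? toℕ p) ∧ does (suc (toℕ p) ≤? upperA i α)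

elems : ∀ {r} → Subset r → List (Fin r)
elems S = List.filter (λ j → j ∈? S) (List.allFin _)

ODList : List ℕ → ℕ
ODList []            = 0
ODList (x ∷ [])      = 0
ODList (x ∷ y ∷ xs)  = (if does ((y ∸ x) % 2 Nat.≟ 1) then 1 else 0) Nat.+ ODList (y ∷ xs)

OD : ∀ {r} → Subset r → ℕ
OD S = ODList (List.map toℕ (elems S))

module Submission where

-- Suppose the blocks A_α, α ∈ S, together contain at least k points, and let K be k of them.
-- Take p(x) = ∏ (r − x) over the roots t(i₁), …, t(i_{d−λ′+1}) together with, for every pair
-- α < α′ of consecutive elements of S at odd distance, a second copy of the root bounding A_α
-- from above; then deg p ≤ d − λ′ + 1 + OD(S) ≤ d. On A_α the sign of p is the parity of the
-- number of roots below A_α, and the doubled roots make this parity the same for all α ∈ S.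
-- Writing p(x) = a₀ + Σ_c a_c x^(c+1), the affine form y ↦ a₀ + Σ_c a_c y_c vanishes on T,
-- hence on aff(T), but has constant strict sign on K, hence on conv(K): the two do not meet.

open import Defs
import Data.Fin
open import Data.Fin as Fin using (Fin; toℕ; fromℕ<)
open import Data.Fin.Subset using (Subset; _∈_; _∉_; _⊆_; _∪_; ⋃; ⊥; ∣_∣; inside; outside)
open import Data.Fin.Subset.Properties using (_∈?_; x∈p∪q⁻; ∉⊥; ∣⊥∣≡0)
open import Data.List using (List; []; _∷_; _∷ʳ_; _++_; map; length; filter; upTo; applyUpTo; allFin; tabulate)
open import Data.List.Membership.Propositional using () renaming (_∈_ to _∈ˡ_)
open import Data.List.Membership.Propositional.Properties using (∈-++⁺ˡ; ∈-allFin; ∈-map⁺)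
open import Data.List.Relation.Unary.All as All using (All; []; _∷_)
import Data.List.Relation.Unary.All.Properties as All
open import Data.List.Relation.Unary.AllPairs as AllPairs using (AllPairs; []; _∷_)
import Data.List.Relation.Unary.AllPairs.Properties as AllPairs
open import Data.List.Relation.Unary.Any as Any using (Any; here; there)
import Data.List.Relation.Unary.Any.Properties as Any
open import Data.Parity.Base as ℙ using (Parity; 0ℙ; 1ℙ; _⁻¹)
open import Data.Product using (Σ; _×_; _,_; proj₁; proj₂)
open import Data.Sum using (_⊎_; inj₁; inj₂)
open import Function using (_∘_; id; Equivalence)
open import Relation.Nullary using (¬_; Dec; does; yes; no; contradiction)
open import Relation.Binary.PropositionalEquality

module OrderedField (R : RealField) where
  open import Level using (0ℓ)
  open import Algebra.Bundles using (CommutativeRing)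
  open import Data.Maybe using (nothing)
  open import Data.Nat using (ℕ; zero; suc; _≤_; z≤n; s≤s)
  open import Data.Nat.Properties using (≤-refl; ≤-trans)
  open import Relation.Binary.Definitions using (tri<; tri≈; tri>)
  open import Relation.Binary.Structures using (IsStrictTotalOrder)
  open RealField R renaming (_≤_ to _≤ℝ_)
  open IsStrictTotalOrder isStrictTotalOrder using (compare) renaming (trans to <-trans; irrefl to <-irrefl)

  commutativeRing : CommutativeRing 0ℓ 0ℓ
  commutativeRing = record { isCommutativeRing = isCommutativeRing }

  open CommutativeRing commutativeRing using
    (+-identityˡ; +-identityʳ; +-assoc; -‿inverseˡ; -‿inverseʳ; *-identityˡ; *-identityʳ;
     distribˡ; zeroˡ; zeroʳ; semiring; *-commutativeSemigroup)
  open import Algebra.Properties.Semiring.Sum semiring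
    using (sum-cong-≗; sum-replicate-zero; *-distribˡ-sum; *-distribʳ-sum; ∑-distrib-+; ∑-comm)
    renaming (sum to ∑)
  open import Algebra.Properties.CommutativeSemigroup *-commutativeSemigroup using (x∙yz≈y∙xz)
  open import Algebra.Properties.Ring (CommutativeRing.ring commutativeRing)
    using (-‿distribˡ-*; -‿distribʳ-*; -‿involutive; -1*x≈-x)
  open import Algebra.Solver.Ring.NaturalCoefficients (CommutativeRing.commutativeSemiring commutativeRing) (λ _ _ → nothing)
    using (solve; _:=_; _:+_; _:*_)

  x<y⇒0<y-x : ∀ {x y} → x < y → 0ℝ < y + - x
  x<y⇒0<y-x {x} {y} x<y = subst (_< y + - x) (-‿inverseʳ x) (+-mono-< (- x) x<y)

  x<y⇒x-y<0 : ∀ {x y} → x < y → x + - y < 0ℝ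
  x<y⇒x-y<0 {x} {y} x<y = subst (x + - y <_) (-‿inverseʳ y) (+-mono-< (- y) x<y)

  x<0⇒0<-x : ∀ {x} → x < 0ℝ → 0ℝ < - x
  x<0⇒0<-x {x} x<0 = subst (0ℝ <_) (+-identityˡ (- x)) (x<y⇒0<y-x x<0)

  0<-x⇒x<0 : ∀ {x} → 0ℝ < - x → x < 0ℝ
  0<-x⇒x<0 {x} 0<-x = subst₂ _<_ (+-identityˡ x) (-‿inverseˡ x) (+-mono-< x 0<-x)

  -x*-y≡x*y : ∀ x y → (- x) * (- y) ≡ x * y
  -x*-y≡x*y x y = begin
    - x * - y      ≡⟨ -‿distribˡ-* x (- y) ⟨
    - (x * - y)    ≡⟨ cong -_ (-‿distribʳ-* x y) ⟨
    - - (x * y)    ≡⟨ -‿involutive (x * y) ⟩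
    x * y          ∎
    where open ≡-Reasoning

  0<1 : 0ℝ < 1ℝ
  0<1 with compare 0ℝ 1ℝ
  ... | tri< 0<1 _ _ = 0<1
  ... | tri≈ _ 0≡1 _ = contradiction 0≡1 0≢1
  ... | tri> _ _ 1<0 = contradiction (<-trans 0<1′ 1<0) (<-irrefl refl)
    where
    0<1′ : 0ℝ < 1ℝ
    0<1′ = subst (0ℝ <_) (trans (-x*-y≡x*y 1ℝ 1ℝ) (*-identityˡ 1ℝ)) (*-pos (x<0⇒0<-x 1<0) (x<0⇒0<-x 1<0))

  Signed : Parity → ℝ → Set
  Signed 0ℙ x = 0ℝ < x
  Signed 1ℙ x = x < 0ℝ

  signed⇒≢0 : ∀ c {x} → Signed c x → x ≢ 0ℝ
  signed⇒≢0 0ℙ 0<x refl = <-irrefl refl 0<x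
  signed⇒≢0 1ℙ x<0 refl = <-irrefl refl x<0

  signed-+ : ∀ c {x y} → Signed c x → Signed c y → Signed c (x + y)
  signed-+ 0ℙ {x} {y} 0<x 0<y = <-trans 0<y (subst (_< x + y) (+-identityˡ y) (+-mono-< y 0<x))
  signed-+ 1ℙ {x} {y} x<0 y<0 = <-trans (subst (x + y <_) (+-identityˡ y) (+-mono-< y x<0)) y<0

  signed-*-pos : ∀ c {a x} → 0ℝ < a → Signed c x → Signed c (a * x)
  signed-*-pos 0ℙ         0<a 0<x = *-pos 0<a 0<x
  signed-*-pos 1ℙ {a} {x} 0<a x<0 = 0<-x⇒x<0 (subst (0ℝ <_) (sym (-‿distribʳ-* a x)) (*-pos 0<a (x<0⇒0<-x x<0)))

  signed-*-neg : ∀ c {a x} → a < 0ℝ → Signed c x → Signed (c ⁻¹) (a * x)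
  signed-*-neg 0ℙ {a} {x} a<0 0<x = 0<-x⇒x<0 (subst (0ℝ <_) (sym (-‿distribˡ-* a x)) (*-pos (x<0⇒0<-x a<0) 0<x))
  signed-*-neg 1ℙ {a} {x} a<0 x<0 = subst (0ℝ <_) (-x*-y≡x*y a x) (*-pos (x<0⇒0<-x a<0) (x<0⇒0<-x x<0))

  Σℝ≡∑ : ∀ {m} (f : Fin m → ℝ) → Σℝ R f ≡ ∑ f
  Σℝ≡∑ {zero}  f = refl
  Σℝ≡∑ {suc m} f = cong (f Fin.zero +_) (Σℝ≡∑ (f ∘ Fin.suc))

  Σℝ≡⇒∑≡ : ∀ {m} (f : Fin m → ℝ) {x} → Σℝ R f ≡ x → ∑ f ≡ x
  Σℝ≡⇒∑≡ f = trans (sym (Σℝ≡∑ f))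

  ∑-signed⊎null : ∀ c {m} (ν g : Fin m → ℝ) → (∀ p → Signed c (g p) ⊎ (ν p ≡ 0ℝ × g p ≡ 0ℝ)) →
                  Signed c (∑ g) ⊎ (∑ ν ≡ 0ℝ × ∑ g ≡ 0ℝ)
  ∑-signed⊎null c {zero}  ν g _     = inj₂ (refl , refl)
  ∑-signed⊎null c {suc m} ν g terms
    with terms Fin.zero | ∑-signed⊎null c (ν ∘ Fin.suc) (g ∘ Fin.suc) (terms ∘ Fin.suc)
  ... | inj₁ g₀ | inj₁ ∑g′         = inj₁ (signed-+ c g₀ ∑g′)
  ... | inj₁ g₀ | inj₂ (_ , ∑g′≡0) =
    inj₁ (subst (Signed c) (sym (trans (cong (g Fin.zero +_) ∑g′≡0) (+-identityʳ _))) g₀)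
  ... | inj₂ (_ , g₀≡0) | inj₁ ∑g′ =
    inj₁ (subst (Signed c) (sym (trans (cong (_+ ∑ (g ∘ Fin.suc)) g₀≡0) (+-identityˡ _))) ∑g′)
  ... | inj₂ (ν₀≡0 , g₀≡0) | inj₂ (∑ν′≡0 , ∑g′≡0) =
    inj₂ ( trans (cong₂ _+_ ν₀≡0 ∑ν′≡0) (+-identityˡ 0ℝ)
         , trans (cong₂ _+_ g₀≡0 ∑g′≡0) (+-identityˡ 0ℝ))

  convex-signed : ∀ c {m} (ν y : Fin m → ℝ) → (∀ p → 0ℝ ≤ℝ ν p) → ∑ ν ≡ 1ℝ →
                  (∀ p → 0ℝ < ν p → Signed c (y p)) → Signed c (∑ λ p → ν p * y p)
  convex-signed c ν y ν≥0 ∑ν≡1 support with ∑-signed⊎null c ν (λ p → ν p * y p) term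
    where
    term : ∀ p → Signed c (ν p * y p) ⊎ (ν p ≡ 0ℝ × ν p * y p ≡ 0ℝ)
    term p with ν≥0 p
    ... | inj₁ 0<νp  = inj₁ (signed-*-pos c 0<νp (support p 0<νp))
    ... | inj₂ 0≡νp = inj₂ (sym 0≡νp , trans (cong (_* y p) (sym 0≡νp)) (zeroˡ (y p)))
  ... | inj₁ signed       = signed
  ... | inj₂ (∑ν≡0 , _) = contradiction (trans (sym ∑ν≡0) ∑ν≡1) 0≢1

  affine : ∀ {d} → ℝ → (Fin d → ℝ) → Point R d → ℝ
  affine a₀ a y = a₀ + ∑ (λ c → a c * y c)

  affine-∑ : ∀ {m d} a₀ (a : Fin d → ℝ) (μ : Fin m → ℝ) (w : Fin m → Point R d) (y : Point R d) →
             ∑ μ ≡ 1ℝ → (∀ c → ∑ (λ j → μ j * w j c) ≡ y c) →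
             affine a₀ a y ≡ ∑ (λ j → μ j * affine a₀ a (w j))
  affine-∑ a₀ a μ w y ∑μ≡1 y≡∑μw = sym (begin
    ∑ (λ j → μ j * (a₀ + ∑ λ c → a c * w j c))
      ≡⟨ sum-cong-≗ (λ j → distribˡ (μ j) a₀ _) ⟩
    ∑ (λ j → μ j * a₀ + μ j * ∑ λ c → a c * w j c)
      ≡⟨ ∑-distrib-+ (λ j → μ j * a₀) _ ⟩
    ∑ (λ j → μ j * a₀) + ∑ (λ j → μ j * ∑ λ c → a c * w j c)
      ≡⟨ cong₂ _+_ constant-part linear-part ⟩
    a₀ + ∑ (λ c → a c * y c) ∎)
    where
    open ≡-Reasoning
    constant-part : ∑ (λ j → μ j * a₀) ≡ a₀
    constant-part = begin
      ∑ (λ j → μ j * a₀) ≡⟨ *-distribʳ-sum a₀ μ ⟨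
      ∑ μ * a₀           ≡⟨ cong (_* a₀) ∑μ≡1 ⟩
      1ℝ * a₀            ≡⟨ *-identityˡ a₀ ⟩
      a₀                 ∎
    linear-part : ∑ (λ j → μ j * ∑ λ c → a c * w j c) ≡ ∑ (λ c → a c * y c)
    linear-part = begin
      ∑ (λ j → μ j * ∑ λ c → a c * w j c)    ≡⟨ sum-cong-≗ (λ j → *-distribˡ-sum (μ j) (λ c → a c * w j c)) ⟩
      ∑ (λ j → ∑ λ c → μ j * (a c * w j c))  ≡⟨ ∑-comm (λ j c → μ j * (a c * w j c)) ⟩
      ∑ (λ c → ∑ λ j → μ j * (a c * w j c))  ≡⟨ sum-cong-≗ (λ c → sum-cong-≗ (λ j → x∙yz≈y∙xz (μ j) (a c) (w j c))) ⟩
      ∑ (λ c → ∑ λ j → a c * (μ j * w j c))  ≡⟨ sum-cong-≗ (λ c → *-distribˡ-sum (a c) (λ j → μ j * w j c)) ⟨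
      ∑ (λ c → a c * ∑ λ j → μ j * w j c)    ≡⟨ sum-cong-≗ (λ c → cong (a c *_) (y≡∑μw c)) ⟩
      ∑ (λ c → a c * y c)                    ∎

  affine-separates : ∀ {d m n} a₀ (a : Fin d → ℝ) c (w : Fin m → Point R d) (v : Fin n → Point R d)
                     (K : Subset n) → (∀ j → affine a₀ a (w j) ≡ 0ℝ) →
                     (∀ p → p ∈ K → Signed c (affine a₀ a (v p))) → ¬ AffMeetsConv R w v K
  affine-separates {d} {m} a₀ a c w v K w-null v-signed
    (y , (μ , Σμ≡1 , y≡Σμw) , (ν , ν≥0 , ν-outside , Σν≡1 , y≡Σνv)) =
    signed⇒≢0 c ℓy-signed ℓy≡0
    where
    ℓ : Point R d → ℝ
    ℓ = affine a₀ a
    ℓy≡0 : ℓ y ≡ 0ℝ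
    ℓy≡0 = begin
      ℓ y
        ≡⟨ affine-∑ a₀ a μ w y (Σℝ≡⇒∑≡ μ Σμ≡1) (λ c → Σℝ≡⇒∑≡ (λ j → μ j * w j c) (y≡Σμw c)) ⟩
      ∑ (λ j → μ j * ℓ (w j))  ≡⟨ sum-cong-≗ {m} (λ j → trans (cong (μ j *_) (w-null j)) (zeroʳ (μ j))) ⟩
      ∑ {m} (λ _ → 0ℝ)         ≡⟨ sum-replicate-zero m ⟩
      0ℝ                       ∎
      where open ≡-Reasoning
    supported : ∀ p → 0ℝ < ν p → Signed c (ℓ (v p))
    supported p 0<νp with p ∈? K
    ... | yes p∈K = v-signed p p∈K
    ... | no  p∉K = contradiction (subst (0ℝ <_) (ν-outside p p∉K) 0<νp) (<-irrefl refl)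
    ℓy-signed : Signed c (ℓ y)
    ℓy-signed = subst (Signed c)
      (sym (affine-∑ a₀ a ν v y (Σℝ≡⇒∑≡ ν Σν≡1) (λ c → Σℝ≡⇒∑≡ (λ p → ν p * v p c) (y≡Σνv c))))
      (convex-signed c ν (ℓ ∘ v) ν≥0 (Σℝ≡⇒∑≡ ν Σν≡1) supported)

  eval : List ℝ → ℝ → ℝ
  eval []       x = 0ℝ
  eval (c ∷ cs) x = c + x * eval cs x

  addConstant : ℝ → List ℝ → List ℝ
  addConstant c []        = c ∷ []
  addConstant c (c′ ∷ cs) = c + c′ ∷ cs

  eval-addConstant : ∀ c cs x → eval (addConstant c cs) x ≡ c + eval cs x
  eval-addConstant c []        x = cong (c +_) (zeroʳ x)
  eval-addConstant c (c′ ∷ cs) x = +-assoc c c′ (x * eval cs x)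

  length-addConstant : ∀ c cs {m} → length cs ≤ suc m → length (addConstant c cs) ≤ suc m
  length-addConstant c []       _          = s≤s z≤n
  length-addConstant c (_ ∷ _)  ∣cs∣≤1+m = ∣cs∣≤1+m

  mulLinear : ℝ → List ℝ → List ℝ
  mulLinear r []       = []
  mulLinear r (c ∷ cs) = r * c ∷ addConstant (- c) (mulLinear r cs)

  eval-mulLinear : ∀ r cs x → eval (mulLinear r cs) x ≡ (r + - x) * eval cs x
  eval-mulLinear r []       x = sym (zeroʳ (r + - x))
  eval-mulLinear r (c ∷ cs) x = begin
    r * c + x * eval (addConstant (- c) (mulLinear r cs)) x
      ≡⟨ cong (λ e′ → r * c + x * e′) (eval-addConstant (- c) (mulLinear r cs) x) ⟩
    r * c + x * (- c + eval (mulLinear r cs) x)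
      ≡⟨ cong (λ e′ → r * c + x * (- c + e′)) (eval-mulLinear r cs x) ⟩
    r * c + x * (- c + (r + - x) * e)
      ≡⟨ cong₂ (λ -c -x → r * c + x * (-c + (r + -x) * e)) (-1*x≈-x c) (-1*x≈-x x) ⟨
    r * c + x * (- 1ℝ * c + (r + - 1ℝ * x) * e)
      ≡⟨ solve 5 (λ r c x n e → r :* c :+ x :* (n :* c :+ (r :+ n :* x) :* e)
                            := (r :+ n :* x) :* (c :+ x :* e)) refl r c x (- 1ℝ) e ⟩
    (r + - 1ℝ * x) * (c + x * e)
      ≡⟨ cong (λ -x → (r + -x) * (c + x * e)) (-1*x≈-x x) ⟩
    (r + - x) * (c + x * e) ∎
    where
    open ≡-Reasoning
    e : ℝ
    e = eval cs x

  length-mulLinear : ∀ r cs → length (mulLinear r cs) ≤ suc (length cs)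
  length-mulLinear r []       = z≤n
  length-mulLinear r (c ∷ cs) = s≤s (length-addConstant (- c) (mulLinear r cs) (length-mulLinear r cs))

  fromRoots : List ℝ → List ℝ
  fromRoots []       = 1ℝ ∷ []
  fromRoots (r ∷ rs) = mulLinear r (fromRoots rs)

  eval-fromRoots-[] : ∀ x → eval (fromRoots []) x ≡ 1ℝ
  eval-fromRoots-[] x = trans (cong (1ℝ +_) (zeroʳ x)) (+-identityʳ 1ℝ)

  length-fromRoots : ∀ rs → length (fromRoots rs) ≤ suc (length rs)
  length-fromRoots []       = ≤-refl
  length-fromRoots (r ∷ rs) = ≤-trans (length-mulLinear r (fromRoots rs)) (s≤s (length-fromRoots rs))

  fromRoots-root : ∀ {x} rs → x ∈ˡ rs → eval (fromRoots rs) x ≡ 0ℝ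
  fromRoots-root {x} (r ∷ rs) (here refl) = begin
    eval (fromRoots (x ∷ rs)) x         ≡⟨ eval-mulLinear x (fromRoots rs) x ⟩
    (x + - x) * eval (fromRoots rs) x   ≡⟨ cong (_* eval (fromRoots rs) x) (-‿inverseʳ x) ⟩
    0ℝ * eval (fromRoots rs) x          ≡⟨ zeroˡ _ ⟩
    0ℝ                                  ∎
    where open ≡-Reasoning
  fromRoots-root {x} (r ∷ rs) (there x∈rs) = begin
    eval (fromRoots (r ∷ rs)) x         ≡⟨ eval-mulLinear r (fromRoots rs) x ⟩
    (r + - x) * eval (fromRoots rs) x   ≡⟨ cong ((r + - x) *_) (fromRoots-root rs x∈rs) ⟩
    (r + - x) * 0ℝ                      ≡⟨ zeroʳ _ ⟩
    0ℝ                                  ∎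
    where open ≡-Reasoning

  coeff : List ℝ → ℕ → ℝ
  coeff []       _       = 0ℝ
  coeff (c ∷ cs) zero    = c
  coeff (c ∷ cs) (suc k) = coeff cs k

  momentForm : (d : ℕ) → List ℝ → Point R d → ℝ
  momentForm d cs = affine (coeff cs 0) (λ c → coeff cs (suc (toℕ c)))

  ∑-coeff-γ : ∀ d cs x → length cs ≤ d → ∑ (λ c → coeff cs (toℕ c) * γ R d x c) ≡ x * eval cs x
  ∑-coeff-γ d [] x _ = begin
    ∑ {d} (λ c → 0ℝ * γ R d x c)   ≡⟨ sum-cong-≗ {d} (λ c → zeroˡ (γ R d x c)) ⟩
    ∑ {d} (λ _ → 0ℝ)               ≡⟨ sum-replicate-zero d ⟩
    0ℝ                             ≡⟨ zeroʳ x ⟨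
    x * 0ℝ                         ∎
    where open ≡-Reasoning
  ∑-coeff-γ (suc d) (c₀ ∷ cs) x (s≤s ∣cs∣≤d) = begin
    c₀ * (x * 1ℝ) + ∑ (λ c → coeff cs (toℕ c) * (x * γ R d x c))
      ≡⟨ cong₂ _+_ (cong (c₀ *_) (*-identityʳ x)) (sum-cong-≗ (λ c → x∙yz≈y∙xz (coeff cs (toℕ c)) x (γ R d x c))) ⟩
    c₀ * x + ∑ (λ c → x * (coeff cs (toℕ c) * γ R d x c))
      ≡⟨ cong (c₀ * x +_) (*-distribˡ-sum x (λ c → coeff cs (toℕ c) * γ R d x c)) ⟨
    c₀ * x + x * ∑ (λ c → coeff cs (toℕ c) * γ R d x c)
      ≡⟨ cong (λ e → c₀ * x + x * e) (∑-coeff-γ d cs x ∣cs∣≤d) ⟩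
    c₀ * x + x * (x * eval cs x)
      ≡⟨ solve 3 (λ c₀ x e → c₀ :* x :+ x :* (x :* e) := x :* (c₀ :+ x :* e)) refl c₀ x (eval cs x) ⟩
    x * (c₀ + x * eval cs x) ∎
    where open ≡-Reasoning

  momentForm-γ : ∀ d cs x → length cs ≤ suc d → momentForm d cs (γ R d x) ≡ eval cs x
  momentForm-γ d []        x _ = trans (+-identityˡ _) (trans (∑-coeff-γ d [] x z≤n) (zeroʳ x))
  momentForm-γ d (c₀ ∷ cs) x (s≤s ∣cs∣≤d) = cong (c₀ +_) (∑-coeff-γ d cs x ∣cs∣≤d)

  momentCurve-separates : ∀ {d m n} (cs : List ℝ) c (s : Fin m → ℝ) (t : Fin n → ℝ) (K : Subset n) →
    length cs ≤ suc d → (∀ j → eval cs (s j) ≡ 0ℝ) → (∀ p → p ∈ K → Signed c (eval cs (t p))) →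
    ¬ AffMeetsConv R (γ R d ∘ s) (γ R d ∘ t) K
  momentCurve-separates {d} cs c s t K ∣cs∣≤1+d s-roots t-signed = affine-separates _ _ c _ _ K
    (λ j → trans (momentForm-γ d cs (s j) ∣cs∣≤1+d) (s-roots j))
    (λ p p∈K → subst (Signed c) (sym (momentForm-γ d cs (t p) ∣cs∣≤1+d)) (t-signed p p∈K))


open import Data.Nat as ℕ using (ℕ; zero; suc; _+_; _∸_; _≤_; _<_; _⊓_; _%_; _<?_; _≤?_; z≤n; s≤s; parity)
open import Data.Nat.Properties
open import Data.Nat.ListAction using (sum)
open import Data.Parity.Properties as ℙ using (+-homo-+)
open import Data.Bool using (true; false; T; _∧_; if_then_else_)
open import Data.Bool.Properties using (T-≡; T-∧)
open import Data.Fin.Properties using (toℕ-injective; toℕ≤pred[n]; toℕ-fromℕ<)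
open import Data.List.Properties using (map-++; map-∘; filter-++; filter-none; filter-accept; filter-reject; length-++; length-map; upTo-∷ʳ; map-upTo; map-tabulate; length-tabulate)
open import Data.Vec using ([]; _∷_; here; there)
open import Data.Vec.Properties using (lookup∘tabulate; []=⇒lookup)

parity-%2 : ∀ n → parity n ≡ (if does (n % 2 ℕ.≟ 1) then 1ℙ else 0ℙ)
parity-%2 zero = refl
parity-%2 (suc zero) = refl
parity-%2 (suc (suc n)) = parity-%2 n

parity-suc : ∀ n → parity (suc n) ≡ parity n ⁻¹
parity-suc = +-homo-+ 1

below : ℕ → List ℕ → ℕ
below a xs = length (filter (_<? a) xs)

below-++ : ∀ a xs ys → below a (xs ++ ys) ≡ below a xs + below a ys
below-++ a xs ys = trans (cong length (filter-++ (_<? a) xs ys)) (length-++ (filter (_<? a) xs))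

below-∷-< : ∀ {a b xs} → b < a → below a (b ∷ xs) ≡ suc (below a xs)
below-∷-< {a} b<a = cong length (filter-accept (_<? a) b<a)

below-∷-≮ : ∀ {a b xs} → ¬ b < a → below a (b ∷ xs) ≡ below a xs
below-∷-≮ {a} b≮a = cong length (filter-reject (_<? a) b≮a)

below-≥ : ∀ {a xs} → All (a ≤_) xs → below a xs ≡ 0
below-≥ a≤xs = cong length (filter-none (_<? _) (All.map ≤⇒≯ a≤xs))

below-upTo : ∀ a M → below a (upTo M) ≡ a ⊓ M
below-upTo a zero = sym (⊓-zeroʳ a)
below-upTo a (suc M) = begin
    below a (upTo (suc M))      ≡⟨ cong (below a) (sym (upTo-∷ʳ M)) ⟩
    below a (upTo M ∷ʳ M)       ≡⟨ below-++ a (upTo M) (M ∷ []) ⟩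
    below a (upTo M) + below a (M ∷ []) ≡⟨ cong (_+ below a (M ∷ [])) (below-upTo a M) ⟩
    a ⊓ M + below a (M ∷ [])    ≡⟨ last-step ⟩
    a ⊓ suc M                   ∎
  where
  open ≡-Reasoning
  last-step : a ⊓ M + below a (M ∷ []) ≡ a ⊓ suc M
  last-step with M <? a
  ... | yes M<a = begin
      a ⊓ M + below a (M ∷ [])  ≡⟨ cong₂ _+_ (m≥n⇒m⊓n≡n (<⇒≤ M<a)) (below-∷-< M<a) ⟩
      M + 1                     ≡⟨ +-comm M 1 ⟩
      suc M                     ≡⟨ sym (m≥n⇒m⊓n≡n M<a) ⟩
      a ⊓ suc M                 ∎
  ... | no M≮a = begin
      a ⊓ M + below a (M ∷ [])  ≡⟨ cong₂ _+_ (m≤n⇒m⊓n≡m (≮⇒≥ M≮a)) (below-∷-≮ M≮a) ⟩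
      a + 0                     ≡⟨ +-identityʳ a ⟩
      a                         ≡⟨ sym (m≤n⇒m⊓n≡m (m≤n⇒m≤1+n (≮⇒≥ M≮a))) ⟩
      a ⊓ suc M                 ∎

toℕ-allFin : ∀ M → map toℕ (allFin M) ≡ upTo M
toℕ-allFin zero = refl
toℕ-allFin (suc M) = cong (0 ∷_) (begin
    map toℕ (tabulate Fin.suc)         ≡⟨ map-tabulate Fin.suc toℕ ⟩
    tabulate (suc ∘ toℕ)               ≡⟨ sym (map-tabulate toℕ suc) ⟩
    map suc (tabulate toℕ)             ≡⟨ cong (map suc) (sym (map-tabulate id toℕ)) ⟩
    map suc (map toℕ (allFin M))       ≡⟨ cong (map suc) (toℕ-allFin M) ⟩
    map suc (upTo M)                   ≡⟨ map-upTo suc M ⟩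
    applyUpTo suc M                    ∎)
  where open ≡-Reasoning

parity-gap : ∀ {a b} → a ≤ b → parity b ≡ parity a ℙ.+ (if does ((b ∸ a) % 2 ℕ.≟ 1) then 1ℙ else 0ℙ)
parity-gap {a} {b} a≤b = begin
  parity b                     ≡⟨ cong parity (sym (m+[n∸m]≡n a≤b)) ⟩
  parity (a + (b ∸ a))         ≡⟨ +-homo-+ a (b ∸ a) ⟩
  parity a ℙ.+ parity (b ∸ a)  ≡⟨ cong (parity a ℙ.+_) (parity-%2 (b ∸ a)) ⟩
  _                            ∎
  where open ≡-Reasoning

-- Positions j of roots t(i j) to be doubled. The simple roots at positions 0, …, M − 1
-- contribute x roots below position x, so x + below x roots counts all roots below x.
record ExtraRoots (M a : ℕ) (as : List ℕ) : Set where
  field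
    roots        : List ℕ
    length-roots : length roots ≡ ODList (a ∷ as)
    roots<M      : All (_< M) roots
    a≤roots      : All (a ≤_) roots
    parity-below : All (λ x → parity (x + below x roots) ≡ parity a) (a ∷ as)

parity-below-least : ∀ {a B} → All (a ≤_) B → parity (a + below a B) ≡ parity a
parity-below-least {a} a≤B = cong parity (trans (cong (a +_) (below-≥ a≤B)) (+-identityʳ a))

extraRoots : ∀ M a as → AllPairs _<_ (a ∷ as) → All (_≤ M) (a ∷ as) → ExtraRoots M a as
extraRoots M a [] _ _ = record
  { roots = [] ; length-roots = refl ; roots<M = [] ; a≤roots = []
  ; parity-below = parity-below-least {a} [] ∷ [] }
extraRoots M a (a′ ∷ as) ((a<a′ ∷ a<as) ∷ increasing) (_ ∷ a′≤M ∷ as≤M)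
  with does ((a′ ∸ a) % 2 ℕ.≟ 1) in odd-gap
... | true = record
  { roots        = a ∷ B
  ; length-roots = trans (cong suc ∣B∣) (cong (λ odd → (if odd then 1 else 0) + ODList (a′ ∷ as)) (sym odd-gap))
  ; roots<M      = <-≤-trans a<a′ a′≤M ∷ B<M
  ; a≤roots      = a≤a∷B
  ; parity-below = parity-below-least a≤a∷B ∷ All.zipWith flipped (a<a′ ∷ a<as , same) }
  where
  open ExtraRoots (extraRoots M a′ as increasing (a′≤M ∷ as≤M))
    renaming (roots to B; length-roots to ∣B∣; roots<M to B<M; a≤roots to a′≤B; parity-below to same)
  a≤a∷B : All (a ≤_) (a ∷ B)
  a≤a∷B = ≤-refl ∷ All.map (≤-trans (<⇒≤ a<a′)) a′≤B
  flipped : ∀ {x} → a < x × parity (x + below x B) ≡ parity a′ → parity (x + below x (a ∷ B)) ≡ parity a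
  flipped {x} (a<x , same-x) = begin
    parity (x + below x (a ∷ B))   ≡⟨ cong (λ b → parity (x + b)) (below-∷-< a<x) ⟩
    parity (x + suc (below x B))   ≡⟨ cong parity (+-suc x (below x B)) ⟩
    parity (suc (x + below x B))   ≡⟨ parity-suc (x + below x B) ⟩
    parity (x + below x B) ⁻¹      ≡⟨ cong _⁻¹ same-x ⟩
    parity a′ ⁻¹                   ≡⟨ cong _⁻¹ (parity-gap (<⇒≤ a<a′)) ⟩
    (parity a ℙ.+ _) ⁻¹            ≡⟨ cong (λ odd → (parity a ℙ.+ (if odd then 1ℙ else 0ℙ)) ⁻¹) odd-gap ⟩
    (parity a ℙ.+ 1ℙ) ⁻¹           ≡⟨ cong _⁻¹ (ℙ.+-comm (parity a) 1ℙ) ⟩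
    parity a ⁻¹ ⁻¹                 ≡⟨ ℙ.⁻¹-involutive (parity a) ⟩
    parity a                       ∎
    where open ≡-Reasoning
... | false = record
  { roots        = B
  ; length-roots = trans ∣B∣ (cong (λ odd → (if odd then 1 else 0) + ODList (a′ ∷ as)) (sym odd-gap))
  ; roots<M      = B<M
  ; a≤roots      = a≤B
  ; parity-below = parity-below-least a≤B ∷ All.map (λ {x} → unchanged {x}) same }
  where
  open ExtraRoots (extraRoots M a′ as increasing (a′≤M ∷ as≤M))
    renaming (roots to B; length-roots to ∣B∣; roots<M to B<M; a≤roots to a′≤B; parity-below to same)
  a≤B : All (a ≤_) B
  a≤B = All.map (≤-trans (<⇒≤ a<a′)) a′≤B
  unchanged : ∀ {x} → parity (x + below x B) ≡ parity a′ → parity (x + below x B) ≡ parity a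
  unchanged {x} same-x = begin
    parity (x + below x B)         ≡⟨ same-x ⟩
    parity a′                      ≡⟨ parity-gap (<⇒≤ a<a′) ⟩
    parity a ℙ.+ _                 ≡⟨ cong (λ odd → parity a ℙ.+ (if odd then 1ℙ else 0ℙ)) odd-gap ⟩
    parity a ℙ.+ 0ℙ                ≡⟨ ℙ.+-identityʳ (parity a) ⟩
    parity a                       ∎
    where open ≡-Reasoning

toFins : ∀ {M} (xs : List ℕ) → All (_< M) xs → List (Fin M)
toFins []       []           = []
toFins (x ∷ xs) (x<M ∷ xs<M) = fromℕ< x<M ∷ toFins xs xs<M

toℕ-toFins : ∀ {M} xs (xs<M : All (_< M) xs) → map toℕ (toFins xs xs<M) ≡ xs
toℕ-toFins []       []           = refl
toℕ-toFins (x ∷ xs) (x<M ∷ xs<M) = cong₂ _∷_ (toℕ-fromℕ< x<M) (toℕ-toFins xs xs<M)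

below-allFin++ : ∀ {M} (β : Fin (suc M)) B (B<M : All (_< M) B) →
                 below (toℕ β) (map toℕ (allFin M ++ toFins B B<M)) ≡ toℕ β + below (toℕ β) B
below-allFin++ {M} β B B<M = begin
  below b (map toℕ (allFin M ++ toFins B B<M))           ≡⟨ cong (below b) (map-++ toℕ (allFin M) (toFins B B<M)) ⟩
  below b (map toℕ (allFin M) ++ map toℕ (toFins B B<M)) ≡⟨ cong₂ (λ xs ys → below b (xs ++ ys)) (toℕ-allFin M) (toℕ-toFins B B<M) ⟩
  below b (upTo M ++ B)                                 ≡⟨ below-++ b (upTo M) B ⟩
  below b (upTo M) + below b B                          ≡⟨ cong (_+ below b B) (below-upTo b M) ⟩
  b ⊓ M + below b B                                     ≡⟨ cong (_+ below b B) (m≤n⇒m⊓n≡m (toℕ≤pred[n] β)) ⟩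
  b + below b B                                         ∎
  where
  open ≡-Reasoning
  b : ℕ
  b = toℕ β

record RootIndices (M : ℕ) (es : List (Fin (suc M))) : Set where
  field
    indices        : List (Fin M)
    length-indices : length indices ≡ M + ODList (map toℕ es)
    ∈-indices      : ∀ j → j ∈ˡ indices
    sign           : Parity
    parity-below   : All (λ α → parity (below (toℕ α) (map toℕ indices)) ≡ sign) es

rootIndices : ∀ {M} (es : List (Fin (suc M))) → AllPairs Fin._<_ es → RootIndices M es
rootIndices {M} [] _ = record
  { indices        = allFin M
  ; length-indices = trans (length-tabulate id) (sym (+-identityʳ M))
  ; ∈-indices      = ∈-allFin
  ; sign           = 0ℙ
  ; parity-below   = [] }
rootIndices {M} (α ∷ es) increasing = record
  { indices        = allFin M ++ toFins roots roots<M
  ; length-indices = begin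
      length (allFin M ++ toFins roots roots<M)        ≡⟨ length-++ (allFin M) ⟩
      length (allFin M) + length (toFins roots roots<M) ≡⟨ cong₂ _+_ (length-tabulate id) ∣roots∣ ⟩
      M + length roots                                  ≡⟨ cong (M +_) length-roots ⟩
      M + ODList (map toℕ (α ∷ es))                     ∎
  ; ∈-indices      = λ j → ∈-++⁺ˡ (∈-allFin j)
  ; sign           = parity (toℕ α)
  ; parity-below   = All.map (λ {β} same → trans (cong parity (below-allFin++ β roots roots<M)) same)
                             (All.map⁻ parity-below) }
  where
  open ≡-Reasoning
  open ExtraRoots (extraRoots M (toℕ α) (map toℕ es) (AllPairs.map⁺ increasing)
                              (All.map⁺ (All.universal toℕ≤pred[n] (α ∷ es))))
  ∣roots∣ : length (toFins roots roots<M) ≡ length roots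
  ∣roots∣ = trans (sym (length-map toℕ (toFins roots roots<M))) (cong length (toℕ-toFins roots roots<M))

Disjoint : ∀ {n} → Subset n → Subset n → Set
Disjoint p q = ∀ {x} → x ∈ p → x ∉ q

∣p∪q∣≡∣p∣+∣q∣ : ∀ {n} (p q : Subset n) → Disjoint p q → ∣ p ∪ q ∣ ≡ ∣ p ∣ + ∣ q ∣
∣p∪q∣≡∣p∣+∣q∣ []            []            _        = refl
∣p∪q∣≡∣p∣+∣q∣ (inside  ∷ p) (inside  ∷ q) disjoint = contradiction here (disjoint here)
∣p∪q∣≡∣p∣+∣q∣ (inside  ∷ p) (outside ∷ q) disjoint =
  cong suc (∣p∪q∣≡∣p∣+∣q∣ p q (λ x∈p x∈q → disjoint (there x∈p) (there x∈q)))
∣p∪q∣≡∣p∣+∣q∣ (outside ∷ p) (inside  ∷ q) disjoint =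
  trans (cong suc (∣p∪q∣≡∣p∣+∣q∣ p q (λ x∈p x∈q → disjoint (there x∈p) (there x∈q)))) (sym (+-suc ∣ p ∣ ∣ q ∣))
∣p∪q∣≡∣p∣+∣q∣ (outside ∷ p) (outside ∷ q) disjoint =
  ∣p∪q∣≡∣p∣+∣q∣ p q (λ x∈p x∈q → disjoint (there x∈p) (there x∈q))

x∈⋃⁻ : ∀ {n} {x : Fin n} ps → x ∈ ⋃ ps → Any (x ∈_) ps
x∈⋃⁻ []       x∈⊥ = contradiction x∈⊥ ∉⊥
x∈⋃⁻ (p ∷ ps) x∈p∪⋃ps with x∈p∪q⁻ p (⋃ ps) x∈p∪⋃ps
... | inj₁ x∈p   = here x∈p
... | inj₂ x∈⋃ps = there (x∈⋃⁻ ps x∈⋃ps)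

∣⋃∣≡sum : ∀ {n} (ps : List (Subset n)) → AllPairs Disjoint ps → ∣ ⋃ ps ∣ ≡ sum (map ∣_∣ ps)
∣⋃∣≡sum {n} []       []                   = ∣⊥∣≡0 n
∣⋃∣≡sum     (p ∷ ps) (p#ps ∷ ps-disjoint) =
  trans (∣p∪q∣≡∣p∣+∣q∣ p (⋃ ps) p#⋃ps) (cong (∣ p ∣ +_) (∣⋃∣≡sum ps ps-disjoint))
  where
  p#⋃ps : Disjoint p (⋃ ps)
  p#⋃ps x∈p x∈⋃ps = All.lookupWith (λ p#q x∈q → p#q x∈p x∈q) p#ps (x∈⋃⁻ ps x∈⋃ps)

⊆-ofSize : ∀ {n} (U : Subset n) k → k ≤ ∣ U ∣ → Σ (Subset n) λ K → ∣ K ∣ ≡ k × K ⊆ U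
⊆-ofSize {n} U zero _ = ⊥ , ∣⊥∣≡0 n , λ x∈⊥ → contradiction x∈⊥ ∉⊥
⊆-ofSize (inside ∷ U) (suc k) (s≤s k≤∣U∣) with ⊆-ofSize U k k≤∣U∣
... | K , ∣K∣ , K⊆U = inside ∷ K , cong suc ∣K∣ , λ { here → here ; (there x∈K) → there (K⊆U x∈K) }
⊆-ofSize (outside ∷ U) (suc k) k≤∣U∣ with ⊆-ofSize U (suc k) k≤∣U∣
... | K , ∣K∣ , K⊆U = outside ∷ K , ∣K∣ , λ { (there x∈K) → there (K⊆U x∈K) }

strict⇒monotone : ∀ {m n} (f : Fin m → Fin n) → (∀ a b → a Fin.< b → f a Fin.< f b) →
                  ∀ {a b} → a Fin.≤ b → f a Fin.≤ f b
strict⇒monotone f f-mono {a} {b} a≤b with m≤n⇒m<n∨m≡n a≤b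
... | inj₁ a<b = <⇒≤ (f-mono a b a<b)
... | inj₂ a≡b = ≤-reflexive (cong (toℕ ∘ f) (toℕ-injective a≡b))

upperA-≤ : ∀ {M n} (i : Fin M → Fin n) → (∀ {a b} → a Fin.≤ b → i a Fin.≤ i b) →
           ∀ (α : Fin (suc M)) β → toℕ α ≤ toℕ β → upperA i α ≤ toℕ (i β)
upperA-≤ {suc M} i i-mono Fin.zero    β           _         = i-mono {Fin.zero} {β} z≤n
upperA-≤ {suc M} i i-mono (Fin.suc α) (Fin.suc β) (s≤s α≤β) = upperA-≤ (i ∘ Fin.suc) (λ a≤b → i-mono (s≤s a≤b)) α β α≤β

module _ {M n} (i : Fin M → Fin n) (i-mono : ∀ a b → a Fin.< b → i a Fin.< i b) where

  ∈blockA⁻ : ∀ {α p} → p ∈ blockA i α → lowerA i α ≤ toℕ p × toℕ p < upperA i α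
  ∈blockA⁻ {α} {p} p∈A = ≤ᵇ⇒≤ _ _ (proj₁ bounds) , ≤ᵇ⇒≤ _ _ (proj₂ bounds)
    where
    bounds : T (does (lowerA i α ≤? toℕ p)) × T (does (suc (toℕ p) ≤? upperA i α))
    bounds = Equivalence.to T-∧ (Equivalence.from T-≡ (trans (sym (lookup∘tabulate _ p)) ([]=⇒lookup p∈A)))

  ∈blockA⇒<i : ∀ {α p} β → p ∈ blockA i α → toℕ α ≤ toℕ β → p Fin.< i β
  ∈blockA⇒<i {α} β p∈A α≤β = <-≤-trans (proj₂ (∈blockA⁻ p∈A)) (upperA-≤ i (strict⇒monotone i i-mono) α β α≤β)

  ∈blockA⇒i< : ∀ {α p} β → p ∈ blockA i α → toℕ β < toℕ α → i β Fin.< p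
  ∈blockA⇒i< {Fin.suc α} β p∈A (s≤s β≤α) = begin-strict
    toℕ (i β)        ≤⟨ strict⇒monotone i i-mono β≤α ⟩
    toℕ (i α)        <⟨ n<1+n _ ⟩
    suc (toℕ (i α))  ≡⟨ sym (lookup∘tabulate (λ j → suc (toℕ (i j))) α) ⟩
    lowerA i (Fin.suc α) ≤⟨ proj₁ (∈blockA⁻ p∈A) ⟩
    toℕ _            ∎
    where open ≤-Reasoning

  blockA-disjoint : ∀ {α α′} → toℕ α < toℕ α′ → Disjoint (blockA i α) (blockA i α′)
  blockA-disjoint {α} {Fin.suc α′} (s≤s α≤α′) p∈A p∈A′ =
    <-asym (∈blockA⇒<i α′ p∈A α≤α′) (∈blockA⇒i< α′ p∈A′ ≤-refl)

  ∣⋃blockA∣ : ∀ {es} → AllPairs Fin._<_ es →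
              ∣ ⋃ (map (blockA i) es) ∣ ≡ sum (map (λ α → ∣ blockA i α ∣) es)
  ∣⋃blockA∣ {es} increasing = begin
    ∣ ⋃ (map (blockA i) es) ∣             ≡⟨ ∣⋃∣≡sum (map (blockA i) es) (AllPairs.map⁺ (AllPairs.map blockA-disjoint increasing)) ⟩
    sum (map ∣_∣ (map (blockA i) es))     ≡⟨ cong sum (map-∘ es) ⟨
    sum (map (λ α → ∣ blockA i α ∣) es)   ∎
    where open ≡-Reasoning

module MomentCurve (R : RealField) {n M} (t : Fin n → RealField.ℝ R)
                   (t-mono : ∀ p q → p Fin.< q → RealField._<_ R (t p) (t q))
                   (i : Fin M → Fin n) (i-mono : ∀ a b → a Fin.< b → i a Fin.< i b) where
  open RealField R using (ℝ; 0ℝ)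
  open OrderedField R

  fromRoots-signed-on-blockA : ∀ {α p} → p ∈ blockA i α → (L : List (Fin M)) →
    Signed (parity (below (toℕ α) (map toℕ L))) (eval (fromRoots (map (t ∘ i) L)) (t p))
  fromRoots-signed-on-blockA {α} {p} _ [] = subst (Signed 0ℙ) (sym (eval-fromRoots-[] (t p))) 0<1
  fromRoots-signed-on-blockA {α} {p} p∈A (β ∷ L) = with-factor (toℕ β <? toℕ α)
    where
    c : Parity
    c = parity (below (toℕ α) (map toℕ L))
    ih : Signed c (eval (fromRoots (map (t ∘ i) L)) (t p))
    ih = fromRoots-signed-on-blockA p∈A L
    with-factor : Dec (toℕ β < toℕ α) →
      Signed (parity (below (toℕ α) (map toℕ (β ∷ L)))) (eval (fromRoots (map (t ∘ i) (β ∷ L))) (t p))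
    with-factor (yes β<α) = subst₂ Signed
      (sym (trans (cong parity (below-∷-< β<α)) (parity-suc (below (toℕ α) (map toℕ L)))))
      (sym (eval-mulLinear (t (i β)) (fromRoots (map (t ∘ i) L)) (t p)))
      (signed-*-neg c (x<y⇒x-y<0 (t-mono (i β) p (∈blockA⇒i< i i-mono β p∈A β<α))) ih)
    with-factor (no β≮α)  = subst₂ Signed
      (sym (cong parity (below-∷-≮ β≮α)))
      (sym (eval-mulLinear (t (i β)) (fromRoots (map (t ∘ i) L)) (t p)))
      (signed-*-pos c (x<y⇒0<y-x (t-mono p (i β) (∈blockA⇒<i i i-mono β p∈A (≮⇒≥ β≮α)))) ih)

  blocks-separated : ∀ {d} es → AllPairs Fin._<_ es → M + ODList (map toℕ es) ≤ d →
    ∀ K → K ⊆ ⋃ (map (blockA i) es) → ¬ AffMeetsConv R (λ j → γ R d (t (i j))) (λ p → γ R d (t p)) K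
  blocks-separated {d} es increasing dim K K⊆U = momentCurve-separates cs sign (t ∘ i) t K degree roots signed
    where
    open RootIndices (rootIndices es increasing)
    cs : List ℝ
    cs = fromRoots (map (t ∘ i) indices)
    degree : length cs ≤ suc d
    degree = ≤-trans (length-fromRoots (map (t ∘ i) indices))
      (s≤s (≤-trans (≤-reflexive (trans (length-map (t ∘ i) indices) length-indices)) dim))
    roots : ∀ j → eval cs (t (i j)) ≡ 0ℝ
    roots j = fromRoots-root (map (t ∘ i) indices) (∈-map⁺ (t ∘ i) (∈-indices j))
    signed : ∀ p → p ∈ K → Signed sign (eval cs (t p))
    signed p p∈K = All.lookupWith
      (λ same p∈A → subst (λ c → Signed c (eval cs (t p))) same (fromRoots-signed-on-blockA p∈A indices))
      parity-below (Any.map⁻ (x∈⋃⁻ _ (K⊆U p∈K)))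

  blocks-small : ∀ {d} k es → AllPairs Fin._<_ es → M + ODList (map toℕ es) ≤ d →
    (∀ K → ∣ K ∣ ≡ k → AffMeetsConv R (λ j → γ R d (t (i j))) (λ p → γ R d (t p)) K) →
    sum (map (λ α → ∣ blockA i α ∣) es) < k
  blocks-small k es increasing dim meets with k ≤? sum (map (λ α → ∣ blockA i α ∣) es)
  ... | no  k≰sum = ≰⇒> k≰sum
  ... | yes k≤sum with ⊆-ofSize (⋃ (map (blockA i) es)) k (subst (k ≤_) (sym (∣⋃blockA∣ i i-mono increasing)) k≤sum)
  ...   | K , ∣K∣≡k , K⊆U = contradiction (meets K ∣K∣≡k) (blocks-separated es increasing dim K K⊆U)

proposition5 : (R : RealField) →
    (k d λ′ n : ℕ) → 1 ≤ λ′ → λ′ ≤ d → λ′ + 1 ≤ k →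
    (t : Fin n → RealField.ℝ R) →
    (∀ p → RealField._<_ R (RealField.0ℝ R) (t p)) →
    (∀ p q → p Data.Fin.< q → RealField._<_ R (t p) (t q)) →
    (i : Fin (suc (d ∸ λ′)) → Fin n) → (∀ a b → a Data.Fin.< b → i a Data.Fin.< i b) →
    (∀ (K : Subset n) → ∣ K ∣ ≡ k →
      AffMeetsConv R (λ j → γ R d (t (i j))) (λ p → γ R d (t p)) K) →
    ∀ (S : Subset (suc (suc (d ∸ λ′)))) → OD S ≤ λ′ ∸ 1 →
    sum (map (λ α → ∣ blockA i α ∣) (elems S)) ≤ k ∸ 1
proposition5 R k d λ′ n 1≤λ′ λ′≤d _ t _ t-mono i i-mono meets S OD≤λ′-1 =
  <⇒≤pred (MomentCurve.blocks-small R t t-mono i i-mono k (elems S) increasing dim meets)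
  where
  increasing : AllPairs Fin._<_ (elems S)
  increasing = AllPairs.filter⁺ (_∈? S) (AllPairs.tabulate⁺-< id)
  dim : suc (d ∸ λ′) + OD S ≤ d
  dim = begin
    suc (d ∸ λ′) + OD S        ≤⟨ +-monoʳ-≤ (suc (d ∸ λ′)) OD≤λ′-1 ⟩
    suc (d ∸ λ′) + (λ′ ∸ 1)    ≡⟨ +-suc (d ∸ λ′) (λ′ ∸ 1) ⟨
    d ∸ λ′ + suc (λ′ ∸ 1)      ≡⟨ cong (d ∸ λ′ +_) (m+[n∸m]≡n 1≤λ′) ⟩
    d ∸ λ′ + λ′                ≡⟨ m∸n+n≡m λ′≤d ⟩
    d                          ∎
    where open ≤-Reasoning
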